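{- For $0 \leq k \leq n$ and $n \geq 2$, $$\mathrm{frst}(n,k) = \mathrm{frst}(n-1,k-1) + \mathrm{frst}(n-1,k) \quad \text{if } k \text{ is even},$$ $$\mathrm{frst}(n,k) = \mathrm{frst}(n-2,k-2) + \mathrm{frst}(n-2,k-1) + \mathrm{frst}(n-2,k) \quad \text{if } k \text{ is odd},$$ and moreover $\mathrm{frst}(0,0)=\mathrm{frst}(1,0)=\mathrm{frst}(1,1)=1$.
   Context: A weak partition is a finite non-decreasing sequence of non-negative integers; its parts are its entries, and the multiplicity of a value is the number of entries equal to it. For $0 \leq k \leq n$, $\mathrm{frst}(n,k)$ is the number of weak partitions with exactly $n-k$ parts, each part at most $k$, such that: (a) if $k$ is even, each odd part has even multiplicity; (b) if $k$ is odd, each even part (including $0$) has even multiplicity. By convention $\mathrm{frst}(n,k)=0$ whenever $k>n$, $k<0$ or $n<0$. -}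

module Defs where

open import Data.Nat using (ℕ; zero; suc; _≤_; _≤?_; _∸_; _<ᵇ_)
open import Data.Nat.Properties using (_≟_)
open import Data.Nat.Divisibility using (_∣_; _∣?_)
open import Data.Integer using (ℤ; +_; -[1+_])
open import Data.List using (List; []; _∷_; length; map; concatMap; upTo; filter)
open import Data.List.Relation.Unary.All using (All; all?)
open import Data.List.Relation.Unary.Linked using (Linked; linked?)
open import Data.Product using (_×_)
open import Data.Bool using (if_then_else_)
open import Relation.Nullary using (¬_; Dec; yes; no; _×-dec_; _→-dec_; ¬?)

Even : ℕ → Set
Even n = 2 ∣ n

Odd : ℕ → Set
Odd n = ¬ (2 ∣ n)

mult : ℕ → List ℕ → ℕ
mult v []       = 0
mult v (x ∷ xs) with v ≟ x
... | yes _ = suc (mult v xs)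
... | no  _ = mult v xs

lists : ℕ → ℕ → List (List ℕ)
lists zero    k = [] ∷ []
lists (suc m) k = concatMap (λ x → map (x ∷_) (lists m k)) (upTo (suc k))

ParityCond : ℕ → List ℕ → Set
ParityCond k xs =
  (Even k → All (λ v → Odd v → Even (mult v xs)) xs) ×
  (Odd k → All (λ v → Even v → Even (mult v xs)) xs)

parityCond? : (k : ℕ) (xs : List ℕ) → Dec (ParityCond k xs)
parityCond? k xs =
  ((2 ∣? k) →-dec all? (λ v → ¬? (2 ∣? v) →-dec (2 ∣? mult v xs)) xs) ×-dec
  (¬? (2 ∣? k) →-dec all? (λ v → (2 ∣? v) →-dec (2 ∣? mult v xs)) xs)

-- the weak partitions counted by frst(n,k) (for k ≤ n): non-decreasing lists
-- of length n ∸ k, parts ≤ k, satisfying the parity condition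
IsFrst : ℕ → List ℕ → Set
IsFrst k xs = Linked _≤_ xs × ParityCond k xs

isFrst? : (k : ℕ) (xs : List ℕ) → Dec (IsFrst k xs)
isFrst? k xs = linked? _≤?_ xs ×-dec parityCond? k xs

frstℕ : ℕ → ℕ → ℕ
frstℕ n k = length (filter (isFrst? k) (lists (n ∸ k) k))

frst : ℤ → ℤ → ℕ
frst -[1+ _ ] _        = 0
frst (+ _)    -[1+ _ ] = 0
frst (+ n)    (+ k)    = if n <ᵇ k then 0 else frstℕ n k

-- A part v of a weak partition counted by frst(n,k) must have even multiplicity exactly when
-- v and k have different parities, so along 0, 1, …, k the values alternate between restricted
-- and free, k itself being free. Let c(a,m) count the admissible partitions with m parts in
-- {a,…,k}. Splitting off the copies of the least value a gives c(a,m) = c(a+1,m) + c(a,m-1)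
-- if a is free and c(a,m) = c(a+1,m) + c(a,m-2) if a is restricted (a restricted value cannot
-- occur once). These recurrences depend only on the number k+1-a of values and on the status
-- of a, so c(a,m) is a function altCount of these two data, and frst(k+m,k) = c(0,m). The
-- claimed identities are the recurrences for the k+1 values 0,…,k read in terms of frst; for k
-- odd the free recurrence is applied a second time, to the values 1,…,k.

module Submission where

open import Defs
open import Data.Nat using (ℕ; zero; suc; _≤_; _<_; _+_; z≤n; s≤s; _<ᵇ_)
open import Data.Nat.Properties
open import Algebra.Properties.CommutativeSemigroup +-commutativeSemigroup using (xy∙z≈xz∙y)
open import Data.Nat.Divisibility using (_∣0; ∣m+n∣m⇒∣n; ∣m∣n⇒∣m+n; ∣-refl; ∣1⇒≡1)
open import Data.Nat.ListAction using (sum)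
open import Data.Nat.ListAction.Properties using (sum-++)
open import Data.Integer using (+_; _-_)
open import Data.Bool using (Bool; true; false; not; _xor_; T)
open import Data.Bool.Properties using (not-involutive; not-injective; not-distribˡ-xor)
open import Data.Unit using (tt)
open import Data.Empty using (⊥-elim)
open import Data.Product using (_×_; _,_)
open import Data.Sum using (inj₁; inj₂; _⊎_)
open import Data.List using (List; []; _∷_; _++_; [_]; length; map; concatMap; upTo; filter)
open import Data.List.Properties
  using (filter-≐; filter-none; filter-++; filter-accept; filter-reject; length-++; map-cong; map-++; upTo-∷ʳ)
open import Data.List.Relation.Unary.All as All using (All; []; _∷_)
open import Data.List.Relation.Unary.Any using (here; there)
open import Data.List.Relation.Unary.Linked as Linked using (Linked; []; [-]; _∷_; linked?)
open import Data.List.Relation.Unary.Linked.Properties using (Linked⇒All)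
open import Data.List.Membership.Propositional using (_∈_)
open import Level using (0ℓ)
open import Function using (_∘_; id; _⇔_; mk⇔; Equivalence)
open import Relation.Nullary using (¬_; Dec; yes; no; _×-dec_; contradiction)
open import Relation.Nullary.Decidable using (map′)
open import Relation.Unary using (Pred; Decidable; _≐_)
open import Relation.Binary.PropositionalEquality hiding ([_])

parity : ℕ → Bool
parity zero    = false
parity (suc n) = not (parity n)

¬even-1 : ¬ Even 1
¬even-1 2∣1 with () ← ∣1⇒≡1 2∣1

even-2+ : ∀ {n} → Even (2 + n) → Even n
even-2+ 2∣2+n = ∣m+n∣m⇒∣n 2∣2+n ∣-refl

2+-even : ∀ {n} → Even n → Even (2 + n)
2+-even = ∣m∣n⇒∣m+n ∣-refl

parity≡false⇒even : ∀ n → parity n ≡ false → Even n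
parity≡true⇒odd   : ∀ n → parity n ≡ true → Odd n
parity≡false⇒even zero          _ = 2 ∣0
parity≡false⇒even (suc zero)    ()
parity≡false⇒even (suc (suc n)) p =
  2+-even (parity≡false⇒even n (trans (sym (not-involutive _)) p))
parity≡true⇒odd zero          ()
parity≡true⇒odd (suc zero)    _ = ¬even-1
parity≡true⇒odd (suc (suc n)) p =
  parity≡true⇒odd n (trans (sym (not-involutive _)) p) ∘ even-2+

even⇒parity≡false : ∀ n → Even n → parity n ≡ false
even⇒parity≡false n even with parity n in p
... | false = refl
... | true  = contradiction even (parity≡true⇒odd n p)

odd⇒parity≡true : ∀ n → Odd n → parity n ≡ true
odd⇒parity≡true n odd with parity n in p
... | true  = refl
... | false = contradiction (parity≡false⇒even n p) odd

restricted : ℕ → ℕ → Bool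
restricted k v = parity v xor parity k

restricted-suc : ∀ k v → restricted k (suc v) ≡ not (restricted k v)
restricted-suc k v = sym (not-distribˡ-xor (parity v) (parity k))

restricted-≢ : ∀ {k a v} → restricted k a ≡ false → restricted k v ≡ true → v ≢ a
restricted-≢ ra rv refl with () ← trans (sym ra) rv

mult-≡ : ∀ v xs → mult v (v ∷ xs) ≡ suc (mult v xs)
mult-≡ v xs with v ≟ v
... | yes _  = refl
... | no v≢v = contradiction refl v≢v

mult-≢ : ∀ {v x} xs → v ≢ x → mult v (x ∷ xs) ≡ mult v xs
mult-≢ {v} {x} xs v≢x with v ≟ x
... | yes v≡x = contradiction v≡x v≢x
... | no _    = refl

mult≡0⊎∈ : ∀ v xs → mult v xs ≡ 0 ⊎ v ∈ xs
mult≡0⊎∈ v []       = inj₁ refl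
mult≡0⊎∈ v (x ∷ xs) with v ≟ x
... | yes v≡x = inj₂ (here v≡x)
... | no _ with mult≡0⊎∈ v xs
...   | inj₁ m≡0 = inj₁ m≡0
...   | inj₂ v∈xs = inj₂ (there v∈xs)

mult-below : ∀ {v} xs → All (v <_) xs → mult v xs ≡ 0
mult-below []       []           = refl
mult-below (x ∷ xs) (v<x ∷ v<xs) = trans (mult-≢ xs (<⇒≢ v<x)) (mult-below xs v<xs)

even-mult-pair : ∀ v a xs → Even (mult v (a ∷ a ∷ xs)) ⇔ Even (mult v xs)
even-mult-pair v a xs = by-cases (v ≟ a)
  where
  by-cases : Dec (v ≡ a) → Even (mult v (a ∷ a ∷ xs)) ⇔ Even (mult v xs)
  by-cases (yes refl) rewrite mult-≡ v (v ∷ xs) | mult-≡ v xs = mk⇔ even-2+ 2+-even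
  by-cases (no v≢a)   rewrite mult-≢ (a ∷ xs) v≢a | mult-≢ xs v≢a = mk⇔ id id

EvenMults : ℕ → List ℕ → Set
EvenMults k xs = ∀ v → restricted k v ≡ true → Even (mult v xs)

ParityCond⇒EvenMults : ∀ {k xs} → ParityCond k xs → EvenMults k xs
ParityCond⇒EvenMults {k} {xs} (evenCase , oddCase) v r
  with mult≡0⊎∈ v xs | parity v in pv | parity k in pk
... | inj₁ m≡0  | _     | _     = subst Even (sym m≡0) (2 ∣0)
... | inj₂ v∈xs | true  | false =
  All.lookup (evenCase (parity≡false⇒even k pk)) v∈xs (parity≡true⇒odd v pv)
... | inj₂ v∈xs | false | true  =
  All.lookup (oddCase (parity≡true⇒odd k pk)) v∈xs (parity≡false⇒even v pv)

EvenMults⇒ParityCond : ∀ {k xs} → EvenMults k xs → ParityCond k xs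
EvenMults⇒ParityCond {k} em =
  (λ even-k → All.tabulate λ {v} _ odd-v →
     em v (cong₂ _xor_ (odd⇒parity≡true v odd-v) (even⇒parity≡false k even-k))) ,
  (λ odd-k → All.tabulate λ {v} _ even-v →
     em v (cong₂ _xor_ (even⇒parity≡false v even-v) (odd⇒parity≡true k odd-k)))

-- Sortedness of a ∷ xs says at once that xs is sorted and that all its parts are at least a.
AdmissibleFrom : ℕ → ℕ → List ℕ → Set
AdmissibleFrom k a xs = Linked _≤_ (a ∷ xs) × EvenMults k xs

admissibleFrom? : ∀ k a → Decidable (AdmissibleFrom k a)
admissibleFrom? k a xs =
  linked? _≤?_ (a ∷ xs) ×-dec map′ ParityCond⇒EvenMults EvenMults⇒ParityCond (parityCond? k xs)

IsFrst≐AdmissibleFrom0 : ∀ {k} → IsFrst k ≐ AdmissibleFrom k 0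
IsFrst≐AdmissibleFrom0 =
  (λ (sorted , pc) → zero-∷ sorted , ParityCond⇒EvenMults pc) ,
  (λ (sorted , em) → Linked.tail sorted , EvenMults⇒ParityCond em)
  where
  zero-∷ : ∀ {xs} → Linked _≤_ xs → Linked _≤_ (0 ∷ xs)
  zero-∷ []           = [-]
  zero-∷ l@[-]        = z≤n ∷ l
  zero-∷ l@(_ ∷ _)    = z≤n ∷ l

admissible-lower : ∀ {k a xs} → AdmissibleFrom k (suc a) xs → AdmissibleFrom k a xs
admissible-lower ([-]         , em) = [-] , em
admissible-lower (a<x ∷ sorted , em) = <⇒≤ a<x ∷ sorted , em

admissible-raise : ∀ {k a x xs} → x ≢ a →
  AdmissibleFrom k a (x ∷ xs) → AdmissibleFrom k (suc a) (x ∷ xs)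
admissible-raise x≢a (a≤x ∷ sorted , em) = ≤∧≢⇒< a≤x (x≢a ∘ sym) ∷ sorted , em

admissible-below : ∀ {k a x xs} → x < a → ¬ AdmissibleFrom k a (x ∷ xs)
admissible-below x<a (a≤x ∷ _ , _) = <⇒≱ x<a a≤x

admissible-unrestricted : ∀ {k a} → restricted k a ≡ false →
  (λ xs → AdmissibleFrom k a (a ∷ xs)) ≐ AdmissibleFrom k a
admissible-unrestricted {k} {a} ra =
  (λ {xs} (sorted , em) → Linked.tail sorted ,
     λ v rv → subst Even (mult-≢ xs (restricted-≢ {k} ra rv)) (em v rv)) ,
  (λ {xs} (sorted , em) → ≤-refl ∷ sorted ,
     λ v rv → subst Even (sym (mult-≢ xs (restricted-≢ {k} ra rv))) (em v rv))

admissible-pair : ∀ {k a} → (λ xs → AdmissibleFrom k a (a ∷ a ∷ xs)) ≐ AdmissibleFrom k a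
admissible-pair {a = a} =
  (λ {xs} (sorted , em) → Linked.tail (Linked.tail sorted) ,
     λ v rv → Equivalence.to (even-mult-pair v a xs) (em v rv)) ,
  (λ {xs} (sorted , em) → ≤-refl ∷ ≤-refl ∷ sorted ,
     λ v rv → Equivalence.from (even-mult-pair v a xs) (em v rv))

admissible-restricted-once : ∀ {k a xs} → restricted k a ≡ true → All (a <_) xs →
  ¬ AdmissibleFrom k a (a ∷ xs)
admissible-restricted-once {a = a} {xs} ra a<xs (_ , em) =
  ¬even-1 (subst Even (trans (mult-≡ a xs) (cong suc (mult-below xs a<xs))) (em a ra))

admissible-restricted-once-∷ : ∀ {k a x xs} → restricted k a ≡ true → x ≢ a →
  ¬ AdmissibleFrom k a (a ∷ x ∷ xs)
admissible-restricted-once-∷ {k} ra x≢a adm@(_ ∷ a≤x ∷ sorted , _) =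
  admissible-restricted-once {k} ra
    (All.map (<-≤-trans (≤∧≢⇒< a≤x (x≢a ∘ sym))) (Linked⇒All ≤-trans ≤-refl sorted)) adm

count : ∀ {A : Set} {P : Pred A 0ℓ} → Decidable P → List A → ℕ
count P? xs = length (filter P? xs)

module _ {A : Set} {P : Pred A 0ℓ} (P? : Decidable P) where

  count-none : (∀ x → ¬ P x) → ∀ xs → count P? xs ≡ 0
  count-none ¬P xs = cong length (filter-none P? (All.universal ¬P xs))

  count-++ : ∀ xs ys → count P? (xs ++ ys) ≡ count P? xs + count P? ys
  count-++ xs ys = trans (cong length (filter-++ P? xs ys)) (length-++ (filter P? xs))

  count-map : ∀ {B : Set} (f : B → A) xs → count P? (map f xs) ≡ count (P? ∘ f) xs
  count-map f []       = refl
  count-map f (x ∷ xs) with P? (f x)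
  ... | yes _ = cong suc (count-map f xs)
  ... | no  _ = count-map f xs

  count-concatMap : ∀ {B : Set} (f : B → List A) xs →
    count P? (concatMap f xs) ≡ sum (map (count P? ∘ f) xs)
  count-concatMap f []       = refl
  count-concatMap f (x ∷ xs) =
    trans (count-++ (f x) (concatMap f xs)) (cong (_+_ (count P? (f x))) (count-concatMap f xs))

count-≐ : ∀ {A : Set} {P Q : Pred A 0ℓ} (P? : Decidable P) (Q? : Decidable Q) →
  P ≐ Q → ∀ xs → count P? xs ≡ count Q? xs
count-≐ P? Q? P≐Q xs = cong length (filter-≐ P? Q? P≐Q xs)

sumBelow : ℕ → (ℕ → ℕ) → ℕ
sumBelow n f = sum (map f (upTo n))

sumBelow-suc : ∀ n f → sumBelow (suc n) f ≡ sumBelow n f + f n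
sumBelow-suc n f = begin
  sum (map f (upTo (suc n)))       ≡⟨ cong (sum ∘ map f) (upTo-∷ʳ n) ⟨
  sum (map f (upTo n ++ [ n ]))    ≡⟨ cong sum (map-++ f (upTo n) [ n ]) ⟩
  sum (map f (upTo n) ++ [ f n ])  ≡⟨ sum-++ (map f (upTo n)) [ f n ] ⟩
  sumBelow n f + (f n + 0)         ≡⟨ cong (_+_ (sumBelow n f)) (+-identityʳ (f n)) ⟩
  sumBelow n f + f n               ∎
  where open ≡-Reasoning

sumBelow-cong : ∀ n {f g} → (∀ {x} → x < n → f x ≡ g x) → sumBelow n f ≡ sumBelow n g
sumBelow-cong zero    f≈g = refl
sumBelow-cong (suc n) {f} {g} f≈g = begin
  sumBelow (suc n) f  ≡⟨ sumBelow-suc n f ⟩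
  sumBelow n f + f n  ≡⟨ cong₂ _+_ (sumBelow-cong n (f≈g ∘ m<n⇒m<1+n)) (f≈g ≤-refl) ⟩
  sumBelow n g + g n  ≡⟨ sumBelow-suc n g ⟨
  sumBelow (suc n) g  ∎
  where open ≡-Reasoning

sumBelow-zero : ∀ n {f} → (∀ {x} → x < n → f x ≡ 0) → sumBelow n f ≡ 0
sumBelow-zero zero    f≈0 = refl
sumBelow-zero (suc n) {f} f≈0 =
  trans (sumBelow-suc n f) (cong₂ _+_ (sumBelow-zero n (f≈0 ∘ m<n⇒m<1+n)) (f≈0 ≤-refl))

sumBelow-split : ∀ n {a f g} → a < n → (∀ {x} → x < n → x ≢ a → f x ≡ g x) → g a ≡ 0 →
  sumBelow n f ≡ sumBelow n g + f a
sumBelow-split (suc n) {a} {f} {g} a<1+n f≈g ga≡0 with m<1+n⇒m<n∨m≡n a<1+n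
... | inj₁ a<n = begin
  sumBelow (suc n) f        ≡⟨ sumBelow-suc n f ⟩
  sumBelow n f + f n        ≡⟨ cong₂ _+_ (sumBelow-split n a<n (f≈g ∘ m<n⇒m<1+n) ga≡0)
                                         (f≈g ≤-refl (<⇒≢ a<n ∘ sym)) ⟩
  sumBelow n g + f a + g n  ≡⟨ xy∙z≈xz∙y (sumBelow n g) (f a) (g n) ⟩
  sumBelow n g + g n + f a  ≡⟨ cong (_+ f a) (sumBelow-suc n g) ⟨
  sumBelow (suc n) g + f a  ∎
  where open ≡-Reasoning
... | inj₂ refl = begin
  sumBelow (suc a) f        ≡⟨ sumBelow-suc a f ⟩
  sumBelow a f + f a        ≡⟨ cong (_+ f a) (sumBelow-cong a (λ x<a → f≈g (m<n⇒m<1+n x<a) (<⇒≢ x<a))) ⟩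
  sumBelow a g + f a        ≡⟨ cong (λ s → s + f a) (+-identityʳ (sumBelow a g)) ⟨
  sumBelow a g + 0 + f a    ≡⟨ cong (λ z → sumBelow a g + z + f a) ga≡0 ⟨
  sumBelow a g + g a + f a  ≡⟨ cong (_+ f a) (sumBelow-suc a g) ⟨
  sumBelow (suc a) g + f a  ∎
  where open ≡-Reasoning

sumBelow-single : ∀ n {a f} → a < n → (∀ {x} → x < n → x ≢ a → f x ≡ 0) → sumBelow n f ≡ f a
sumBelow-single n {a} {f} a<n f≈0 =
  trans (sumBelow-split n a<n f≈0 refl) (cong (_+ f a) (sumBelow-zero n (λ _ → refl)))

count-lists-suc : ∀ {P : Pred (List ℕ) 0ℓ} (P? : Decidable P) m k →
  count P? (lists (suc m) k) ≡ sumBelow (suc k) (λ x → count (P? ∘ (x ∷_)) (lists m k))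
count-lists-suc P? m k =
  trans (count-concatMap P? (λ x → map (x ∷_) (lists m k)) (upTo (suc k)))
        (cong sum (map-cong (λ x → count-map P? (x ∷_) (lists m k)) (upTo (suc k))))

prev : (ℕ → ℕ) → ℕ → ℕ
prev f zero    = 0
prev f (suc m) = f m

StrictlyCausal : ((ℕ → ℕ) → ℕ → ℕ) → Set
StrictlyCausal D = ∀ {f g} m → (∀ {i} → i < m → f i ≡ g i) → D f m ≡ D g m

prev-strictlyCausal : StrictlyCausal prev
prev-strictlyCausal zero    _     = refl
prev-strictlyCausal (suc m) f≈g = f≈g ≤-refl

prev²-strictlyCausal : StrictlyCausal (prev ∘ prev)
prev²-strictlyCausal zero    _     = refl
prev²-strictlyCausal (suc m) f≈g = prev-strictlyCausal m (f≈g ∘ m<n⇒m<1+n)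

solution-unique : ∀ {D} → StrictlyCausal D → ∀ {h f g : ℕ → ℕ} →
  (∀ m → f m ≡ h m + D f m) → (∀ m → g m ≡ h m + D g m) → ∀ m → f m ≡ g m
solution-unique {D} causal {h} {f} {g} f-rec g-rec m = agree-below (suc m) ≤-refl
  where
  agree-below : ∀ m {i} → i < m → f i ≡ g i
  agree-below (suc m) i<1+m with m<1+n⇒m<n∨m≡n i<1+m
  ... | inj₁ i<m  = agree-below m i<m
  ... | inj₂ refl = begin
    f m            ≡⟨ f-rec m ⟩
    h m + D f m    ≡⟨ cong (_+_ (h m)) (causal m (agree-below m)) ⟩
    h m + D g m    ≡⟨ g-rec m ⟨
    g m            ∎
    where open ≡-Reasoning

countFrom : ℕ → ℕ → ℕ → ℕ
countFrom k a m = count (admissibleFrom? k a) (lists m k)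

countMin : ℕ → ℕ → ℕ → ℕ
countMin k a m = count (admissibleFrom? k a ∘ (a ∷_)) (lists m k)

countFrom-zero : ∀ k a → countFrom k a 0 ≡ 1
countFrom-zero k a = cong length (filter-accept (admissibleFrom? k a) ([-] , λ _ _ → 2 ∣0))

countFrom-top : ∀ k m → countFrom k (suc k) (suc m) ≡ 0
countFrom-top k m = trans (count-lists-suc (admissibleFrom? k (suc k)) m k)
  (sumBelow-zero (suc k) λ x<1+k → count-none _ (λ _ → admissible-below {k} x<1+k) (lists m k))

countFrom-suc : ∀ {k a} → a ≤ k → ∀ m →
  countFrom k a (suc m) ≡ countFrom k (suc a) (suc m) + countMin k a m
countFrom-suc {k} {a} a≤k m = begin
  countFrom k a (suc m)
    ≡⟨ count-lists-suc (admissibleFrom? k a) m k ⟩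
  sumBelow (suc k) (headed a)
    ≡⟨ sumBelow-split (suc k) (s≤s a≤k) same-count no-head-a ⟩
  sumBelow (suc k) (headed (suc a)) + countMin k a m
    ≡⟨ cong (_+ countMin k a m) (count-lists-suc (admissibleFrom? k (suc a)) m k) ⟨
  countFrom k (suc a) (suc m) + countMin k a m
    ∎
  where
  open ≡-Reasoning
  headed : ℕ → ℕ → ℕ
  headed b x = count (admissibleFrom? k b ∘ (x ∷_)) (lists m k)
  same-count : ∀ {x} → x < suc k → x ≢ a → headed a x ≡ headed (suc a) x
  same-count _ x≢a = count-≐ _ _ (admissible-raise {k} x≢a , admissible-lower {k}) (lists m k)
  no-head-a : headed (suc a) a ≡ 0
  no-head-a = count-none _ (λ _ → admissible-below {k} ≤-refl) (lists m k)

countMin-unrestricted : ∀ {k a} → restricted k a ≡ false → ∀ m → countMin k a m ≡ countFrom k a m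
countMin-unrestricted {k} {a} ra m = count-≐ _ _ (admissible-unrestricted {k} ra) (lists m k)

countMin-restricted : ∀ {k a} → a ≤ k → restricted k a ≡ true → ∀ m →
  countMin k a m ≡ prev (countFrom k a) m
countMin-restricted {k} {a} a≤k ra zero =
  cong length (filter-reject (admissibleFrom? k a ∘ (a ∷_)) (admissible-restricted-once {k} ra []))
countMin-restricted {k} {a} a≤k ra (suc m) = begin
  countMin k a (suc m)         ≡⟨ count-lists-suc (admissibleFrom? k a ∘ (a ∷_)) m k ⟩
  sumBelow (suc k) headed      ≡⟨ sumBelow-single (suc k) (s≤s a≤k) none-single ⟩
  headed a                     ≡⟨ count-≐ _ _ (admissible-pair {k}) (lists m k) ⟩
  countFrom k a m              ∎
  where
  open ≡-Reasoning
  headed : ℕ → ℕ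
  headed x = count (admissibleFrom? k a ∘ (a ∷_) ∘ (x ∷_)) (lists m k)
  none-single : ∀ {x} → x < suc k → x ≢ a → headed x ≡ 0
  none-single _ x≢a = count-none _ (λ _ → admissible-restricted-once-∷ {k} ra x≢a) (lists m k)

countFrom-prev : ∀ {k a} → a ≤ k → ∀ m → countFrom k a m ≡ countFrom k (suc a) m + prev (countMin k a) m
countFrom-prev {k} {a} _   zero    = trans (countFrom-zero k a) (cong (_+ 0) (sym (countFrom-zero k (suc a))))
countFrom-prev         a≤k (suc m) = countFrom-suc a≤k m

countFrom-unrestricted : ∀ {k a} → a ≤ k → restricted k a ≡ false → ∀ m →
  countFrom k a m ≡ countFrom k (suc a) m + prev (countFrom k a) m
countFrom-unrestricted a≤k ra zero    = countFrom-prev a≤k zero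
countFrom-unrestricted {k} {a} a≤k ra (suc m) =
  trans (countFrom-prev a≤k (suc m)) (cong (_+_ (countFrom k (suc a) (suc m))) (countMin-unrestricted ra m))

countFrom-restricted : ∀ {k a} → a ≤ k → restricted k a ≡ true → ∀ m →
  countFrom k a m ≡ countFrom k (suc a) m + prev (prev (countFrom k a)) m
countFrom-restricted a≤k ra zero    = countFrom-prev a≤k zero
countFrom-restricted {k} {a} a≤k ra (suc m) =
  trans (countFrom-prev a≤k (suc m)) (cong (_+_ (countFrom k (suc a) (suc m))) (countMin-restricted a≤k ra m))

-- altCount r d m counts the weak partitions with m parts from d consecutive values that are
-- alternately restricted and free, the least one being restricted iff r.
altCount : Bool → ℕ → ℕ → ℕ
altCount _     _       zero          = 1
altCount _     zero    (suc _)       = 0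
altCount false (suc d) (suc m)       = altCount true d (suc m) + altCount false (suc d) m
altCount true  (suc d) (suc zero)    = altCount false d (suc zero)
altCount true  (suc d) (suc (suc m)) = altCount false d (suc (suc m)) + altCount true (suc d) m

altCount-unrestricted : ∀ d m → altCount false (suc d) m ≡ altCount true d m + prev (altCount false (suc d)) m
altCount-unrestricted d zero    = refl
altCount-unrestricted d (suc m) = refl

altCount-restricted : ∀ d m →
  altCount true (suc d) m ≡ altCount false d m + prev (prev (altCount true (suc d))) m
altCount-restricted d zero          = refl
altCount-restricted d (suc zero)    = sym (+-identityʳ _)
altCount-restricted d (suc (suc m)) = refl

altCount-one-free-value : ∀ m → altCount false 1 m ≡ 1
altCount-one-free-value zero    = refl
altCount-one-free-value (suc m) = altCount-one-free-value m

countFrom-altCount : ∀ {k} d a → d + a ≡ suc k → ∀ m → countFrom k a m ≡ altCount (restricted k a) d m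
countFrom-altCount {k} zero    a refl zero    = countFrom-zero k a
countFrom-altCount {k} zero    a refl (suc m) = countFrom-top k m
countFrom-altCount {k} (suc d) a d+a≡k = by-restriction (restricted k a) refl
  where
  a≤k : a ≤ k
  a≤k = subst (a ≤_) (suc-injective d+a≡k) (m≤n+m a d)
  next : ∀ {r} → restricted k a ≡ r → ∀ m → countFrom k (suc a) m ≡ altCount (not r) d m
  next refl m = trans (countFrom-altCount d (suc a) (trans (+-suc d a) d+a≡k) m)
                      (cong (λ r → altCount r d m) (restricted-suc k a))
  by-restriction : ∀ r → restricted k a ≡ r → ∀ m → countFrom k a m ≡ altCount r (suc d) m
  by-restriction false ra = solution-unique prev-strictlyCausal
    (λ m → trans (countFrom-unrestricted a≤k ra m) (cong (_+ _) (next ra m))) (altCount-unrestricted d)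
  by-restriction true  ra = solution-unique prev²-strictlyCausal
    (λ m → trans (countFrom-restricted a≤k ra m) (cong (_+ _) (next ra m))) (altCount-restricted d)

frst-≤ : ∀ {n k} → k ≤ n → frst (+ n) (+ k) ≡ frstℕ n k
frst-≤ {n} {k} k≤n with n <ᵇ k in n<ᵇk
... | false = refl
... | true  = contradiction (<ᵇ⇒< n k (subst T (sym n<ᵇk) tt)) (≤⇒≯ k≤n)

frst-> : ∀ {n k} → n < k → frst (+ n) (+ k) ≡ 0
frst-> {n} {k} n<k with n <ᵇ k in n<ᵇk
... | true  = refl
... | false = ⊥-elim (subst T n<ᵇk (<⇒<ᵇ n<k))

frst-altCount : ∀ k m → frst (+ (k + m)) (+ k) ≡ altCount (parity k) (suc k) m
frst-altCount k m = begin
  frst (+ (k + m)) (+ k)           ≡⟨ frst-≤ (m≤m+n k m) ⟩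
  frstℕ (k + m) k                  ≡⟨ cong (λ l → count (isFrst? k) (lists l k)) (m+n∸m≡n k m) ⟩
  count (isFrst? k) (lists m k)    ≡⟨ count-≐ _ _ (IsFrst≐AdmissibleFrom0 {k}) (lists m k) ⟩
  countFrom k 0 m                  ≡⟨ countFrom-altCount (suc k) 0 (+-identityʳ (suc k)) m ⟩
  altCount (parity k) (suc k) m    ∎
  where open ≡-Reasoning

frst-altCount-prev : ∀ k m → frst (+ (k + m)) (+ suc k) ≡ prev (altCount (parity (suc k)) (2 + k)) m
frst-altCount-prev k zero    = frst-> (s≤s (≤-reflexive (+-identityʳ k)))
frst-altCount-prev k (suc m) = trans (cong (λ n → frst (+ n) (+ suc k)) (+-suc k m)) (frst-altCount (suc k) m)

frst-altCount-prev² : ∀ k m → frst (+ (k + m)) (+ (2 + k)) ≡ prev (prev (altCount (parity (2 + k)) (3 + k))) m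
frst-altCount-prev² k zero    = frst-> (m<n⇒m<1+n (s≤s (≤-reflexive (+-identityʳ k))))
frst-altCount-prev² k (suc m) =
  trans (cong (λ n → frst (+ n) (+ (2 + k))) (+-suc k m)) (frst-altCount-prev (suc k) m)

frst[n,0]≡1 : ∀ n → frst (+ n) (+ 0) ≡ 1
frst[n,0]≡1 n = trans (frst-altCount 0 n) (altCount-one-free-value n)

-- For k ≤ 1 the terms frst(_, k - j) with k - j < 0 vanish definitionally.
frst-even : ∀ k m → 2 ≤ k + m → Even k →
  frst (+ (k + m)) (+ k) ≡ frst (+ (k + m) - + 1) (+ k - + 1) + frst (+ (k + m) - + 1) (+ k)
frst-even zero    (suc m) _ _    = trans (frst[n,0]≡1 (suc m)) (sym (frst[n,0]≡1 m))
frst-even (suc k) m       _ even = begin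
  frst (+ (suc k + m)) (+ suc k)
    ≡⟨ frst-altCount (suc k) m ⟩
  altCount (parity (suc k)) (2 + k) m
    ≡⟨ recurrence (parity k) (not-injective (even⇒parity≡false (suc k) even)) ⟩
  altCount (parity k) (suc k) m + prev (altCount (parity (suc k)) (2 + k)) m
    ≡⟨ cong₂ _+_ (frst-altCount k m) (frst-altCount-prev k m) ⟨
  frst (+ (k + m)) (+ k) + frst (+ (k + m)) (+ suc k)
    ∎
  where
  open ≡-Reasoning
  recurrence : ∀ r → r ≡ true →
    altCount (not r) (2 + k) m ≡ altCount r (suc k) m + prev (altCount (not r) (2 + k)) m
  recurrence _ refl = altCount-unrestricted (suc k) m

frst-odd : ∀ k m → 2 ≤ k + m → Odd k →
  frst (+ (k + m)) (+ k) ≡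
  frst (+ (k + m) - + 2) (+ k - + 2) + frst (+ (k + m) - + 2) (+ k - + 1) + frst (+ (k + m) - + 2) (+ k)
frst-odd zero          _       _        odd = contradiction (2 ∣0) odd
frst-odd (suc zero)    zero    (s≤s ()) _
frst-odd (suc zero)    (suc m) _        _   = begin
  frst (+ (2 + m)) (+ 1)
    ≡⟨ frst-altCount 1 (suc m) ⟩
  altCount true 2 (suc m)
    ≡⟨ altCount-restricted 1 (suc m) ⟩
  altCount false 1 (suc m) + prev (altCount true 2) m
    ≡⟨ cong₂ _+_ (trans (frst[n,0]≡1 m) (sym (altCount-one-free-value (suc m)))) (frst-altCount-prev 0 m) ⟨
  frst (+ m) (+ 0) + frst (+ m) (+ 1)
    ∎
  where open ≡-Reasoning
frst-odd (suc (suc k)) m       _        odd = begin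
  frst (+ (2 + k + m)) (+ (2 + k))
    ≡⟨ frst-altCount (2 + k) m ⟩
  altCount (parity (2 + k)) (3 + k) m
    ≡⟨ recurrence (parity k) (trans (sym (not-involutive _)) (odd⇒parity≡true (2 + k) odd)) ⟩
  altCount (parity k) (suc k) m + prev (altCount (parity (suc k)) (2 + k)) m
    + prev (prev (altCount (parity (2 + k)) (3 + k))) m
    ≡⟨ cong₂ _+_ (cong₂ _+_ (frst-altCount k m) (frst-altCount-prev k m)) (frst-altCount-prev² k m) ⟨
  frst (+ (k + m)) (+ k) + frst (+ (k + m)) (+ suc k) + frst (+ (k + m)) (+ (2 + k))
    ∎
  where
  open ≡-Reasoning
  recurrence : ∀ r → r ≡ true →
    altCount (not (not r)) (3 + k) m ≡
    altCount r (suc k) m + prev (altCount (not r) (2 + k)) m + prev (prev (altCount (not (not r)) (3 + k))) m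
  recurrence _ refl = trans (altCount-restricted (2 + k) m)
    (cong (_+ prev (prev (altCount true (3 + k))) m) (altCount-unrestricted (suc k) m))

FrstRecurrence : ℕ → ℕ → Set
FrstRecurrence n k =
  (Even k → frst (+ n) (+ k) ≡ frst (+ n - + 1) (+ k - + 1) + frst (+ n - + 1) (+ k)) ×
  (Odd k → frst (+ n) (+ k) ≡ frst (+ n - + 2) (+ k - + 2) + frst (+ n - + 2) (+ k - + 1) + frst (+ n - + 2) (+ k))

frst-recurrence : ∀ {n k} → k ≤ n → 2 ≤ n → FrstRecurrence n k
frst-recurrence {k = k} k≤n with m , refl ← m≤n⇒∃[o]m+o≡n k≤n =
  λ 2≤n → frst-even k m 2≤n , frst-odd k m 2≤n

theorem3p3 : ((n k : ℕ) → k ≤ n → 2 ≤ n →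
      (Even k → frst (+ n) (+ k) ≡ frst (+ n - + 1) (+ k - + 1) + frst (+ n - + 1) (+ k)) ×
      (Odd k → frst (+ n) (+ k) ≡ frst (+ n - + 2) (+ k - + 2) + frst (+ n - + 2) (+ k - + 1) + frst (+ n - + 2) (+ k)))
    × (frst (+ 0) (+ 0) ≡ 1) × (frst (+ 1) (+ 0) ≡ 1) × (frst (+ 1) (+ 1) ≡ 1)
theorem3p3 = (λ _ _ → frst-recurrence) , refl , refl , refl
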